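{- Let $G$ be a finite simple $(P_2\cup P_4,\ \text{diamond})$-free graph with $\omega(G)=5$. Let $A$ be a maximum clique of $G$, let $H=G-A$ be nonempty, and let $k=\omega(H)$. If $k=3$, then $\chi(G)=5$.
   Context: $P_2\cup P_4$ is the disjoint union of a path on 2 vertices and a path on 4 vertices; the diamond is $K_4$ minus one edge; $H$-free means no induced subgraph isomorphic to $H$. $\chi$ and $\omega$ denote chromatic number and clique number; $G-A$ is the graph obtained by deleting the vertices of $A$. -}

module Defs where

open import Data.Nat using (ℕ; _≤_; _≡ᵇ_)
open import Data.Bool using (Bool; true; false; _∨_; _∧_)
open import Data.Bool.Properties using (∨-comm)
open import Data.Fin using (Fin; zero; suc; toℕ)
open import Data.Fin.Subset using (Subset; _∈_; _∉_; _⊆_; ∣_∣; ∁)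
open import Data.List using (List; []; _∷_)
open import Data.Bool.ListAction using (any)
open import Data.Product using (Σ; ∃; _×_; _,_)
open import Function.Definitions using (Injective)
open import Relation.Binary.PropositionalEquality using (_≡_; _≢_; refl)
open import Relation.Nullary using (¬_)

record Graph (n : ℕ) : Set where
  field
    adj    : Fin n → Fin n → Bool
    sym    : ∀ u v → adj u v ≡ adj v u
    irrefl : ∀ v → adj v v ≡ false
open Graph public

record InducedCopy {m n : ℕ} (F : Graph m) (G : Graph n) : Set where
  field
    f       : Fin m → Fin n
    f-inj   : Injective _≡_ _≡_ f
    f-adj   : ∀ i j → adj G (f i) (f j) ≡ adj F i j

Free : {m n : ℕ} → Graph m → Graph n → Set
Free F G = ¬ InducedCopy F G

private
  hasEdge : List (ℕ × ℕ) → ℕ → ℕ → Bool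
  hasEdge es i j = any (λ { (a , b) → (a ≡ᵇ i) ∧ (b ≡ᵇ j) }) es

  symAdj : {m : ℕ} → List (ℕ × ℕ) → Fin m → Fin m → Bool
  symAdj es i j = hasEdge es (toℕ i) (toℕ j) ∨ hasEdge es (toℕ j) (toℕ i)

P2∪P4-edges : List (ℕ × ℕ)
P2∪P4-edges = (0 , 1) ∷ (2 , 3) ∷ (3 , 4) ∷ (4 , 5) ∷ []

P2∪P4 : Graph 6
P2∪P4 = record
  { adj    = symAdj P2∪P4-edges
  ; sym    = λ u v → ∨-comm (hasEdge P2∪P4-edges (toℕ u) (toℕ v)) _
  ; irrefl = irr
  }
  where
  irr : ∀ v → symAdj P2∪P4-edges v v ≡ false
  irr zero = refl
  irr (suc zero) = refl
  irr (suc (suc zero)) = refl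
  irr (suc (suc (suc zero))) = refl
  irr (suc (suc (suc (suc zero)))) = refl
  irr (suc (suc (suc (suc (suc zero))))) = refl

diamond-edges : List (ℕ × ℕ)
diamond-edges = (0 , 1) ∷ (0 , 2) ∷ (0 , 3) ∷ (1 , 2) ∷ (1 , 3) ∷ []

diamond : Graph 4
diamond = record
  { adj    = symAdj diamond-edges
  ; sym    = λ u v → ∨-comm (hasEdge diamond-edges (toℕ u) (toℕ v)) _
  ; irrefl = irr
  }
  where
  irr : ∀ v → symAdj diamond-edges v v ≡ false
  irr zero = refl
  irr (suc zero) = refl
  irr (suc (suc zero)) = refl
  irr (suc (suc (suc zero))) = refl

IsClique : {n : ℕ} → Graph n → Subset n → Set
IsClique G K = ∀ u v → u ∈ K → v ∈ K → u ≢ v → adj G u v ≡ true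

CliqueNumberOn : {n : ℕ} → Graph n → Subset n → ℕ → Set
CliqueNumberOn G S w =
  (∃ λ K → K ⊆ S × IsClique G K × ∣ K ∣ ≡ w)
  × (∀ K → K ⊆ S → IsClique G K → ∣ K ∣ ≤ w)

CliqueNumber : {n : ℕ} → Graph n → ℕ → Set
CliqueNumber {n} G w = CliqueNumberOn G (Data.Fin.Subset.⊤) w

IsMaximumClique : {n : ℕ} → Graph n → Subset n → Set
IsMaximumClique G A = IsClique G A × (∀ K → IsClique G K → ∣ K ∣ ≤ ∣ A ∣)

IsProperColouring : {n c : ℕ} → Graph n → (Fin n → Fin c) → Set
IsProperColouring G col = ∀ u v → adj G u v ≡ true → col u ≢ col v

ChromaticNumber : {n : ℕ} → Graph n → ℕ → Set
ChromaticNumber {n} G c =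
  (Σ (Fin n → Fin c) λ col → IsProperColouring G col)
  × (∀ d → (col : Fin n → Fin d) → IsProperColouring G col → c ≤ d)

{-# OPTIONS --safe #-}
-- Colour A with 0, …, 4 and then the vertices of H = G − A by first fit, in the order of the index
-- of their neighbour in A (a vertex of H has at most one: a second one would give a diamond or,
-- if it saw all of A, a K₆), vertices without such a neighbour last. First fit never needs a
-- sixth colour. If a vertex v saw all five colours, the first-fit witnesses of its neighbours
-- would produce induced P4s in H, and an induced P4 of H meets four distinct classes, since two
-- vertices of A missing it would complete an induced P2 ∪ P4. Together with the fact that every
-- edge of H lies in at most one triangle of H (no diamond, no K₄), a case analysis on the classes
-- of the neighbours of v rules this out. The clique A shows that five colours are necessary.
module Submission where

open import Defs hiding (sym)
open import Data.Bool using (true; false)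
import Data.Bool.Properties as Bool
open import Data.Empty using (⊥; ⊥-elim; ⊥-elim-irr)
open import Data.Fin as Fin using (Fin; Fin′; zero; suc; toℕ; fromℕ<; combine; inject; _<_; _<?_)
open import Data.Fin.Patterns using (0F; 1F; 2F; 3F; 4F; 5F)
open import Data.Fin.Properties
  using (any?; all?; ¬∀⟶∃¬; ¬∀⟶∃¬-smallest; <-cmp; suc-injective; toℕ-injective; toℕ<n; toℕ-fromℕ<;
         toℕ-inject; combine-injectiveʳ; combine-monoˡ-<; injective⇒≤)
open import Data.Fin.Subset using (Subset; _∈_; _∉_; _∪_; ⁅_⁆; ∣_∣; _⊆_; ∁; inside; outside)
open import Data.Fin.Subset.Properties
  using (_∈?_; ∈⊤; x∈⁅x⁆; x∈⁅y⁆⇒x≡y; x∉p⇒x∈∁p; ∣⁅x⁆∣≡1; p⊆p∪q; x∈p∪q⁺; x∈p∪q⁻; p⊂q⇒∣p∣<∣q∣)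
open import Data.Irrelevant using ([_])
open import Data.Nat as ℕ using (ℕ; zero; suc; s≤s; z≤n; _≤_)
open import Data.Nat.Properties
  using (≤-refl; ≤-trans; <-trans; ≤-<-trans; <⇒≤; <⇒≱; <⇒≢; ≮⇒≥; ≤∧≢⇒<; <-irrefl; <-asym; ≤-pred;
         ≤-antisym; n≤0⇒n≡0; n<1⇒n≡0; m≤n⇒m≤1+n; m≤n⇒m<n∨m≡n)
open import Data.Product using (∃; ∃₂; Σ; _×_; _,_; proj₁; proj₂; map₂)
open import Data.Refinement using (Refinement-syntax; _,_; value; value-injective)
import Data.Refinement as Refinement
open import Data.Sum as Sum using (_⊎_; inj₁; inj₂; [_,_]′)
open import Data.Vec.Base using (Vec; []; _∷_; here; there; lookup)
open import Function using (_∘_; id)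
open import Function.Definitions using (Injective)
open import Relation.Binary.Definitions using (tri<; tri≈; tri>)
open import Relation.Binary.PropositionalEquality using (_≡_; _≢_; refl; sym; trans; cong; subst; subst₂)
open import Relation.Nullary using (¬_; Dec; yes; no; contradiction)
open import Relation.Nullary.Decidable as Dec
  using (True; False; toWitness; toWitnessFalse; decidable-stable; ¬?; _×-dec_; _→-dec_)

record Enumeration {n : ℕ} (S : Subset n) (m : ℕ) : Set where
  field
    elem           : Fin m → Fin n
    elem-injective : Injective _≡_ _≡_ elem
    elem∈          : ∀ i → elem i ∈ S
    elem-onto      : ∀ {y} → y ∈ S → ∃ λ i → elem i ≡ y

enumerate : ∀ {n} (S : Subset n) → Enumeration S ∣ S ∣
enumerate [] = record { elem = λ () ; elem-injective = λ {} ; elem∈ = λ () ; elem-onto = λ {y} () }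
enumerate (outside ∷ S) = record
  { elem = suc ∘ elem
  ; elem-injective = elem-injective ∘ suc-injective
  ; elem∈ = there ∘ elem∈
  ; elem-onto = λ { (there y∈S) → map₂ (cong suc) (elem-onto y∈S) }
  }
  where open Enumeration (enumerate S)
enumerate (inside ∷ S) = record { elem = elem′ ; elem-injective = injective ; elem∈ = elem′∈ ; elem-onto = onto }
  where
  open Enumeration (enumerate S)
  elem′ : Fin (suc ∣ S ∣) → Fin _
  elem′ zero = zero
  elem′ (suc i) = suc (elem i)
  injective : Injective _≡_ _≡_ elem′
  injective {zero} {zero} _ = refl
  injective {suc i} {suc j} eq = cong suc (elem-injective (suc-injective eq))
  elem′∈ : ∀ i → elem′ i ∈ inside ∷ S
  elem′∈ zero = here
  elem′∈ (suc i) = there (elem∈ i)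
  onto : ∀ {y} → y ∈ inside ∷ S → ∃ λ i → elem′ i ≡ y
  onto here = zero , refl
  onto (there y∈S) = let i , eq = elem-onto y∈S in suc i , cong suc eq

∈∪⁅⁆⁻ : ∀ {n} {K : Subset n} {u y} → u ∈ K ∪ ⁅ y ⁆ → u ∈ K ⊎ u ≡ y
∈∪⁅⁆⁻ {K = K} {y = y} u∈ = Sum.map₂ (x∈⁅y⁆⇒x≡y y) (x∈p∪q⁻ K ⁅ y ⁆ u∈)

uncovered : ∀ {m k} (c : Fin m → ℕ) → m ℕ.< k → ∃ λ (j : Fin k) → ∀ i → c i ≢ toℕ j
uncovered {m} {k} c m<k with any? (λ j → all? (λ i → ¬? (c i ℕ.≟ toℕ j)))
... | yes found = found
... | no none = contradiction (injective⇒≤ cover-injective) (<⇒≱ m<k)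
  where
  hit : ∀ j → ∃ λ i → c i ≡ toℕ j
  hit j = map₂ (decidable-stable (c _ ℕ.≟ toℕ j))
               (¬∀⟶∃¬ m _ (λ i → ¬? (c i ℕ.≟ toℕ j)) (λ avoided → none (j , avoided)))
  cover-injective : Injective _≡_ _≡_ (proj₁ ∘ hit)
  cover-injective {j} {j′} eq =
    toℕ-injective (trans (sym (proj₂ (hit j))) (trans (cong c eq) (proj₂ (hit j′))))

two-uncovered : (c : Vec ℕ 3) →
  ∃₂ λ (j k : Fin 5) → j ≢ k × (∀ i → lookup c i ≢ toℕ j) × (∀ i → lookup c i ≢ toℕ k)
two-uncovered c with uncovered (lookup c) (s≤s (s≤s (s≤s (s≤s z≤n))))
... | j , c≢j with uncovered (lookup (toℕ j ∷ c)) ≤-refl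
... | k , c′≢k = j , k , (λ j≡k → c′≢k zero (cong toℕ j≡k)) , c≢j , c′≢k ∘ suc

between-1-and-2 : ∀ {c} → 0 ℕ.< c → c ℕ.< 3 → c ≡ 1 ⊎ c ≡ 2
between-1-and-2 {1} _ _ = inj₁ refl
between-1-and-2 {2} _ _ = inj₂ refl
between-1-and-2 {suc (suc (suc _))} _ (s≤s (s≤s (s≤s ())))

≤1∧≢0⇒≡1 : ∀ {c} → c ≤ 1 → c ≢ 0 → c ≡ 1
≤1∧≢0⇒≡1 {0} _ c≢0 = contradiction refl c≢0
≤1∧≢0⇒≡1 {1} _ _ = refl
≤1∧≢0⇒≡1 {suc (suc _)} (s≤s ())

record AllDistinct (c₁ c₂ c₃ c₄ : ℕ) : Set where
  field
    c₁≢c₂ : c₁ ≢ c₂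
    c₁≢c₃ : c₁ ≢ c₃
    c₁≢c₄ : c₁ ≢ c₄
    c₂≢c₃ : c₂ ≢ c₃
    c₂≢c₄ : c₂ ≢ c₄
    c₃≢c₄ : c₃ ≢ c₄

open AllDistinct

Twins : ∀ {m} → Graph m → Fin m → Fin m → Set
Twins F i j = ∀ k → adj F i k ≡ adj F j k

P2∪P4-twin-free : ∀ i j → i < j → ¬ Twins P2∪P4 i j
P2∪P4-twin-free = toWitness {a? = all? λ i → all? λ j →
  i <? j →-dec ¬? (all? λ k → adj P2∪P4 i k Bool.≟ adj P2∪P4 j k)} _

diamond-twins : ∀ i j → i < j → Twins diamond i j → i ≡ 2F × j ≡ 3F
diamond-twins = toWitness {a? = all? λ i → all? λ j →
  i <? j →-dec (all? λ k → adj diamond i k Bool.≟ adj diamond j k) →-dec (i Fin.≟ 2F ×-dec j Fin.≟ 3F)} _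

module _ {n : ℕ} (G : Graph n) where

  adj-sym : ∀ {x y b} → adj G x y ≡ b → adj G y x ≡ b
  adj-sym {x} {y} xy = trans (Graph.sym G y x) xy

  adj⇒≢ : ∀ {x y} → adj G x y ≡ true → x ≢ y
  adj⇒≢ {x} xy refl = contradiction (trans (sym xy) (irrefl G x)) λ ()

  singleton-clique : ∀ y → IsClique G ⁅ y ⁆
  singleton-clique y u v u∈ v∈ u≢v = contradiction (trans (x∈⁅y⁆⇒x≡y y u∈) (sym (x∈⁅y⁆⇒x≡y y v∈))) u≢v

  extend-clique : ∀ {K y} → IsClique G K → (∀ {u} → u ∈ K → adj G u y ≡ true) →
    IsClique G (K ∪ ⁅ y ⁆) × ∣ K ∣ ℕ.< ∣ K ∪ ⁅ y ⁆ ∣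
  extend-clique {K} {y} K-clique K~y = clique , p⊂q⇒∣p∣<∣q∣ (p⊆p∪q _ , y , x∈p∪q⁺ (inj₂ (x∈⁅x⁆ y)) , y∉K)
    where
    y∉K : y ∉ K
    y∉K y∈K = adj⇒≢ (K~y y∈K) refl
    clique : IsClique G (K ∪ ⁅ y ⁆)
    clique u v u∈ v∈ u≢v with ∈∪⁅⁆⁻ u∈ | ∈∪⁅⁆⁻ v∈
    ... | inj₁ u∈K | inj₁ v∈K = K-clique u v u∈K v∈K u≢v
    ... | inj₁ u∈K | inj₂ refl = K~y u∈K
    ... | inj₂ refl | inj₁ v∈K = adj-sym (K~y v∈K)
    ... | inj₂ refl | inj₂ refl = contradiction refl u≢v

  -- An adjacency-preserving map can only identify twins, so injectivity needs checking on twins only.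
  module Embedding {m} (F : Graph m) (f : Fin m → Fin n)
    (f-adj< : ∀ {i j} → i < j → adj G (f i) (f j) ≡ adj F i j) where

    f-adj : ∀ i j → adj G (f i) (f j) ≡ adj F i j
    f-adj i j with <-cmp i j
    ... | tri< i<j _ _ = f-adj< i<j
    ... | tri≈ _ refl _ = trans (irrefl G (f i)) (sym (irrefl F i))
    ... | tri> _ _ j<i = trans (Graph.sym G (f i) (f j)) (trans (f-adj< j<i) (Graph.sym F j i))

    ≡⇒twins : ∀ {i j} → f i ≡ f j → Twins F i j
    ≡⇒twins {i} {j} fi≡fj k = trans (sym (f-adj i k)) (trans (cong (λ x → adj G x (f k)) fi≡fj) (f-adj j k))

    copy : (∀ {i j} → i < j → Twins F i j → f i ≢ f j) → InducedCopy F G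
    copy twins-apart = record { f = f ; f-inj = injective ; f-adj = f-adj }
      where
      injective : Injective _≡_ _≡_ f
      injective {i} {j} fi≡fj with <-cmp i j
      ... | tri< i<j _ _ = contradiction fi≡fj (twins-apart i<j (≡⇒twins fi≡fj))
      ... | tri≈ _ i≡j _ = i≡j
      ... | tri> _ _ j<i = contradiction (sym fi≡fj) (twins-apart j<i (≡⇒twins (sym fi≡fj)))

  record InducedP4 (x₁ x₂ x₃ x₄ : Fin n) : Set where
    constructor induced-P4
    field
      x₁x₂ : adj G x₁ x₂ ≡ true
      x₂x₃ : adj G x₂ x₃ ≡ true
      x₃x₄ : adj G x₃ x₄ ≡ true
      x₁x₃ : adj G x₁ x₃ ≡ false
      x₁x₄ : adj G x₁ x₄ ≡ false
      x₂x₄ : adj G x₂ x₄ ≡ false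

  Anticomplete : Fin n → Fin n → Fin n → Fin n → Fin n → Set
  Anticomplete u x₁ x₂ x₃ x₄ =
    adj G u x₁ ≡ false × adj G u x₂ ≡ false × adj G u x₃ ≡ false × adj G u x₄ ≡ false

  diamond-free⇒common-neighbours-adjacent : Free diamond G → ∀ {c₁ c₂ t₁ t₂} →
    adj G c₁ c₂ ≡ true → adj G c₁ t₁ ≡ true → adj G c₁ t₂ ≡ true →
    adj G c₂ t₁ ≡ true → adj G c₂ t₂ ≡ true → t₁ ≢ t₂ → adj G t₁ t₂ ≡ true
  diamond-free⇒common-neighbours-adjacent free {c₁} {c₂} {t₁} {t₂} c₁c₂ c₁t₁ c₁t₂ c₂t₁ c₂t₂ t₁≢t₂
    with adj G t₁ t₂ in t₁t₂
  ... | true = refl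
  ... | false = contradiction (copy twins-apart) free
    where
    f : Fin 4 → Fin n
    f 0F = c₁
    f 1F = c₂
    f 2F = t₁
    f 3F = t₂

    f-adj< : ∀ {i j} → i < j → adj G (f i) (f j) ≡ adj diamond i j
    f-adj< {0F} {1F} _ = c₁c₂
    f-adj< {0F} {2F} _ = c₁t₁
    f-adj< {0F} {3F} _ = c₁t₂
    f-adj< {1F} {2F} _ = c₂t₁
    f-adj< {1F} {3F} _ = c₂t₂
    f-adj< {2F} {3F} _ = t₁t₂
    f-adj< {_} {0F} ()
    f-adj< {suc _} {1F} (s≤s ())
    f-adj< {suc (suc _)} {2F} (s≤s (s≤s ()))
    f-adj< {suc (suc (suc _))} {3F} (s≤s (s≤s (s≤s ())))

    open Embedding diamond f f-adj<

    twins-apart : ∀ {i j} → i < j → Twins diamond i j → f i ≢ f j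
    twins-apart {i} {j} i<j twins with diamond-twins i j i<j twins
    ... | refl , refl = t₁≢t₂

  P2∪P4-free⇒no-edge-anticomplete-to-P4 : Free P2∪P4 G → ∀ {u₀ u₁ x₁ x₂ x₃ x₄} →
    adj G u₀ u₁ ≡ true → InducedP4 x₁ x₂ x₃ x₄ →
    Anticomplete u₀ x₁ x₂ x₃ x₄ → Anticomplete u₁ x₁ x₂ x₃ x₄ → ⊥
  P2∪P4-free⇒no-edge-anticomplete-to-P4 free {u₀} {u₁} {x₁} {x₂} {x₃} {x₄} u₀u₁
    (induced-P4 x₁x₂ x₂x₃ x₃x₄ x₁x₃ x₁x₄ x₂x₄) (u₀x₁ , u₀x₂ , u₀x₃ , u₀x₄) (u₁x₁ , u₁x₂ , u₁x₃ , u₁x₄) =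
    free (copy λ i<j twins → contradiction twins (P2∪P4-twin-free _ _ i<j))
    where
    f : Fin 6 → Fin n
    f 0F = u₀
    f 1F = u₁
    f 2F = x₁
    f 3F = x₂
    f 4F = x₃
    f 5F = x₄

    f-adj< : ∀ {i j} → i < j → adj G (f i) (f j) ≡ adj P2∪P4 i j
    f-adj< {0F} {1F} _ = u₀u₁
    f-adj< {0F} {2F} _ = u₀x₁
    f-adj< {0F} {3F} _ = u₀x₂
    f-adj< {0F} {4F} _ = u₀x₃
    f-adj< {0F} {5F} _ = u₀x₄
    f-adj< {1F} {2F} _ = u₁x₁
    f-adj< {1F} {3F} _ = u₁x₂
    f-adj< {1F} {4F} _ = u₁x₃
    f-adj< {1F} {5F} _ = u₁x₄
    f-adj< {2F} {3F} _ = x₁x₂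
    f-adj< {2F} {4F} _ = x₁x₃
    f-adj< {2F} {5F} _ = x₁x₄
    f-adj< {3F} {4F} _ = x₂x₃
    f-adj< {3F} {5F} _ = x₂x₄
    f-adj< {4F} {5F} _ = x₃x₄
    f-adj< {_} {0F} ()
    f-adj< {suc _} {1F} (s≤s ())
    f-adj< {suc (suc _)} {2F} (s≤s (s≤s ()))
    f-adj< {suc (suc (suc _))} {3F} (s≤s (s≤s (s≤s ())))
    f-adj< {suc (suc (suc (suc _)))} {4F} (s≤s (s≤s (s≤s (s≤s ()))))
    f-adj< {suc (suc (suc (suc (suc _))))} {5F} (s≤s (s≤s (s≤s (s≤s (s≤s ())))))

    open Embedding P2∪P4 f f-adj<

module Structure {n : ℕ} {G : Graph n} (P2∪P4-free : Free P2∪P4 G) (diamond-free : Free diamond G)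
  {A : Subset n} (A-maximum : IsMaximumClique G A) (∣A∣≡5 : ∣ A ∣ ≡ 5)
  (ω[H]≤3 : ∀ K → K ⊆ ∁ A → IsClique G K → ∣ K ∣ ≤ 3) where

  open Enumeration (subst (Enumeration A) ∣A∣≡5 (enumerate A))
    renaming (elem to a; elem-injective to a-injective; elem∈ to a∈A; elem-onto to A⊆a)

  a-adj : ∀ {j k} → j ≢ k → adj G (a j) (a k) ≡ true
  a-adj j≢k = proj₁ A-maximum _ _ (a∈A _) (a∈A _) (j≢k ∘ a-injective)

  H : Set
  H = [ x ∈ Fin n ∣ x ∉ A ]

  value∉A : (x : H) → value x ∉ A
  value∉A (x , [ x∉A ]) x∈A = ⊥-elim-irr (x∉A x∈A)

  value≢a : ∀ (x : H) k → value x ≢ a k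
  value≢a x k x≡a = value∉A x (subst (_∈ A) (sym x≡a) (a∈A k))

  -- Records rather than equations, so that the vertices can be inferred from adjacency proofs.
  infix 4 _~_ _≁_ _~ᴬ_ _≁ᴬ_

  record _~_ (x y : H) : Set where
    constructor edge
    field adjacent : adj G (value x) (value y) ≡ true

  record _≁_ (x y : H) : Set where
    constructor non-edge
    field non-adjacent : adj G (value x) (value y) ≡ false

  record _~ᴬ_ (x : H) (k : Fin 5) : Set where
    constructor edgeᴬ
    field adjacentᴬ : adj G (value x) (a k) ≡ true

  record _≁ᴬ_ (x : H) (k : Fin 5) : Set where
    constructor non-edgeᴬ
    field non-adjacentᴬ : adj G (value x) (a k) ≡ false

  open _~_
  open _≁_
  open _~ᴬ_
  open _≁ᴬ_

  ~-sym : ∀ {x y} → x ~ y → y ~ x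
  ~-sym (edge e) = edge (adj-sym G e)

  ≁-sym : ∀ {x y} → x ≁ y → y ≁ x
  ≁-sym (non-edge e) = non-edge (adj-sym G e)

  ~⇒¬≁ : ∀ {x y} → x ~ y → ¬ x ≁ y
  ~⇒¬≁ (edge e) (non-edge f) = contradiction (trans (sym e) f) λ ()

  ~? : ∀ x y → x ~ y ⊎ x ≁ y
  ~? x y with adj G (value x) (value y) in e
  ... | true = inj₁ (edge e)
  ... | false = inj₂ (non-edge e)

  ~ᴬ? : ∀ x k → x ~ᴬ k ⊎ x ≁ᴬ k
  ~ᴬ? x k with adj G (value x) (a k) in e
  ... | true = inj₁ (edgeᴬ e)
  ... | false = inj₂ (non-edgeᴬ e)

  no-vertex-complete-to-A : (x : H) → ¬ (∀ k → x ~ᴬ k)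
  no-vertex-complete-to-A x x~A = <⇒≱ (proj₂ A∪x) (proj₂ A-maximum _ (proj₁ A∪x))
    where
    A~x : ∀ {y} → y ∈ A → adj G y (value x) ≡ true
    A~x y∈A with A⊆a y∈A
    ... | k , refl = adj-sym G (adjacentᴬ (x~A k))
    A∪x = extend-clique G (proj₁ A-maximum) A~x

  one-A-neighbour : ∀ {x j k} → x ~ᴬ j → x ~ᴬ k → j ≡ k
  one-A-neighbour {x} {j} {k} (edgeᴬ x~j) (edgeᴬ x~k)
    with j Fin.≟ k | all? (λ l → adj G (value x) (a l) Bool.≟ true)
  ... | yes j≡k | _ = j≡k
  ... | no j≢k | yes x~A = contradiction (edgeᴬ ∘ x~A) (no-vertex-complete-to-A x)
  ... | no j≢k | no x≁A with ¬∀⟶∃¬ 5 _ (λ l → adj G (value x) (a l) Bool.≟ true) x≁A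
  ...   | l , x≁l = ⊥-elim (x≁l (diamond-free⇒common-neighbours-adjacent G diamond-free
          (a-adj j≢k) (adj-sym G x~j) (a-adj j≢l) (adj-sym G x~k) (a-adj k≢l) (value≢a x l)))
    where
    j≢l : j ≢ l
    j≢l refl = x≁l x~j
    k≢l : k ≢ l
    k≢l refl = x≁l x~k

  -- 5 encodes "no neighbour in A", which puts such vertices last in the colouring order.
  -- A hypothesis named x∈Bᵢ states class x ≡ i.
  opaque
    class : H → ℕ
    class x with any? (λ k → adj G (value x) (a k) Bool.≟ true)
    ... | yes (k , _) = toℕ k
    ... | no _ = 5

    class≤5 : ∀ x → class x ≤ 5
    class≤5 x with any? (λ k → adj G (value x) (a k) Bool.≟ true)
    ... | yes (k , _) = <⇒≤ (toℕ<n k)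
    ... | no _ = ≤-refl

    class⇒~ᴬ : ∀ {x} k → class x ≡ toℕ k → x ~ᴬ k
    class⇒~ᴬ {x} k eq with any? (λ k → adj G (value x) (a k) Bool.≟ true)
    ... | yes (j , x~j) = edgeᴬ (subst (λ j → adj G (value x) (a j) ≡ true) (toℕ-injective eq) x~j)
    ... | no _ = contradiction (subst (ℕ._< 5) (sym eq) (toℕ<n k)) (<-irrefl refl)

    ~ᴬ⇒class : ∀ {x k} → x ~ᴬ k → class x ≡ toℕ k
    ~ᴬ⇒class {x} {k} x~k with any? (λ k → adj G (value x) (a k) Bool.≟ true)
    ... | yes (j , x~j) = cong toℕ (one-A-neighbour (edgeᴬ x~j) x~k)
    ... | no none = contradiction (k , adjacentᴬ x~k) none

  class≢⇒≁ᴬ : ∀ {x} k → class x ≢ toℕ k → x ≁ᴬ k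
  class≢⇒≁ᴬ {x} k ≢k with ~ᴬ? x k
  ... | inj₁ x~k = contradiction (~ᴬ⇒class x~k) ≢k
  ... | inj₂ x≁k = x≁k

  class≢ : ∀ {x c′ c} → class x ≡ c′ → {False (c′ ℕ.≟ c)} → class x ≢ c
  class≢ cx {c′≢c} eq = toWitnessFalse c′≢c (trans (sym cx) eq)

  K₄ : H → H → H → H → Subset n
  K₄ w x y z = ((⁅ value w ⁆ ∪ ⁅ value x ⁆) ∪ ⁅ value y ⁆) ∪ ⁅ value z ⁆

  K₄⊆∁A : ∀ w x y z → K₄ w x y z ⊆ ∁ A
  K₄⊆∁A w x y z u∈ with ∈∪⁅⁆⁻ u∈
  ... | inj₂ refl = x∉p⇒x∈∁p (value∉A z)
  ... | inj₁ u∈K₃ with ∈∪⁅⁆⁻ u∈K₃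
  ...   | inj₂ refl = x∉p⇒x∈∁p (value∉A y)
  ...   | inj₁ u∈K₂ with ∈∪⁅⁆⁻ u∈K₂
  ...     | inj₂ refl = x∉p⇒x∈∁p (value∉A x)
  ...     | inj₁ u∈K₁ rewrite x∈⁅y⁆⇒x≡y _ u∈K₁ = x∉p⇒x∈∁p (value∉A w)

  K₄-clique : ∀ {w x y z} → w ~ x → w ~ y → w ~ z → x ~ y → x ~ z → y ~ z →
    IsClique G (K₄ w x y z) × 3 ℕ.< ∣ K₄ w x y z ∣
  K₄-clique {w} {x} {y} {z} (edge wx) (edge wy) (edge wz) (edge xy) (edge xz) (edge yz) =
    proj₁ K₄′ , ≤-trans (s≤s (≤-trans (s≤s 1<∣K₂∣) (proj₂ K₃′))) (proj₂ K₄′)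
    where
    K₁~x : ∀ {u} → u ∈ ⁅ value w ⁆ → adj G u (value x) ≡ true
    K₁~x u∈ rewrite x∈⁅y⁆⇒x≡y _ u∈ = wx
    K₂~ : ∀ {u t} → adj G (value w) t ≡ true → adj G (value x) t ≡ true →
      u ∈ ⁅ value w ⁆ ∪ ⁅ value x ⁆ → adj G u t ≡ true
    K₂~ wt xt u∈ with ∈∪⁅⁆⁻ u∈
    ... | inj₁ u∈K₁ rewrite x∈⁅y⁆⇒x≡y _ u∈K₁ = wt
    ... | inj₂ refl = xt
    K₃~z : ∀ {u} → u ∈ (⁅ value w ⁆ ∪ ⁅ value x ⁆) ∪ ⁅ value y ⁆ → adj G u (value z) ≡ true
    K₃~z u∈ with ∈∪⁅⁆⁻ u∈
    ... | inj₁ u∈K₂ = K₂~ wz xz u∈K₂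
    ... | inj₂ refl = yz
    K₂′ = extend-clique G (singleton-clique G (value w)) K₁~x
    K₃′ = extend-clique G (proj₁ K₂′) (K₂~ wy xy)
    K₄′ = extend-clique G (proj₁ K₃′) K₃~z
    1<∣K₂∣ = subst (ℕ._< ∣ ⁅ value w ⁆ ∪ ⁅ value x ⁆ ∣) (∣⁅x⁆∣≡1 (value w)) (proj₂ K₂′)

  no-K4 : ∀ {w x y z} → w ~ x → w ~ y → w ~ z → x ~ y → x ~ z → y ~ z → ⊥
  no-K4 {w} {x} {y} {z} wx wy wz xy xz yz =
    <⇒≱ (proj₂ clique) (ω[H]≤3 (K₄ w x y z) (K₄⊆∁A w x y z) (proj₁ clique))
    where clique = K₄-clique wx wy wz xy xz yz

  edge-in-one-triangle : ∀ {x y p q} → x ~ y → x ~ p → y ~ p → x ~ q → y ~ q → p ≡ q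
  edge-in-one-triangle {p = p} {q} xy xp yp xq yq with Refinement._≟_ Fin._≟_ p q
  ... | yes p≡q = p≡q
  ... | no p≢q = ⊥-elim (no-K4 xy xp xq yp yq (edge (diamond-free⇒common-neighbours-adjacent G diamond-free
          (adjacent xy) (adjacent xp) (adjacent xq) (adjacent yp) (adjacent yq) (p≢q ∘ value-injective))))

  same-class-closed : ∀ {x y z} k → x ~ y → class x ≡ toℕ k → class y ≡ toℕ k → z ~ x → z ~ y → class z ≡ toℕ k
  same-class-closed {z = z} k xy x∈Bk y∈Bk zx zy = ~ᴬ⇒class (edgeᴬ (adj-sym G
    (diamond-free⇒common-neighbours-adjacent G diamond-free (adjacent xy)
      (adjacentᴬ (class⇒~ᴬ k x∈Bk)) (adjacent (~-sym zx)) (adjacentᴬ (class⇒~ᴬ k y∈Bk)) (adjacent (~-sym zy))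
      (λ ak≡z → value≢a z k (sym ak≡z)))))

  record P4 (x₁ x₂ x₃ x₄ : H) : Set where
    constructor p4
    field
      x₁x₂ : x₁ ~ x₂
      x₂x₃ : x₂ ~ x₃
      x₃x₄ : x₃ ~ x₄
      x₁x₃ : x₁ ≁ x₃
      x₁x₄ : x₁ ≁ x₄
      x₂x₄ : x₂ ≁ x₄

  P4⇒induced : ∀ {x₁ x₂ x₃ x₄} → P4 x₁ x₂ x₃ x₄ → InducedP4 G (value x₁) (value x₂) (value x₃) (value x₄)
  P4⇒induced (p4 x₁x₂ x₂x₃ x₃x₄ x₁x₃ x₁x₄ x₂x₄) = induced-P4
    (adjacent x₁x₂) (adjacent x₂x₃) (adjacent x₃x₄) (non-adjacent x₁x₃) (non-adjacent x₁x₄) (non-adjacent x₂x₄)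

  Avoids : ℕ → H → H → H → H → Set
  Avoids c x₁ x₂ x₃ x₄ = class x₁ ≢ c × class x₂ ≢ c × class x₃ ≢ c × class x₄ ≢ c

  misses : ∀ {x} k → class x ≢ toℕ k → adj G (a k) (value x) ≡ false
  misses k x∉Bk = adj-sym G (non-adjacentᴬ (class≢⇒≁ᴬ k x∉Bk))

  P4-meets-edge-to-A : ∀ {w k x₁ x₂ x₃ x₄} → w ~ᴬ k → P4 x₁ x₂ x₃ x₄ →
    w ≁ x₁ → w ≁ x₂ → w ≁ x₃ → w ≁ x₄ → Avoids (toℕ k) x₁ x₂ x₃ x₄ → ⊥
  P4-meets-edge-to-A {k = k} (edgeᴬ w~k) p w₁ w₂ w₃ w₄ (k₁ , k₂ , k₃ , k₄) =
    P2∪P4-free⇒no-edge-anticomplete-to-P4 G P2∪P4-free (adj-sym G w~k) (P4⇒induced p)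
      (misses k k₁ , misses k k₂ , misses k k₃ , misses k k₄)
      (non-adjacent w₁ , non-adjacent w₂ , non-adjacent w₃ , non-adjacent w₄)

  P4-meets-A-edge : ∀ {x₁ x₂ x₃ x₄} → P4 x₁ x₂ x₃ x₄ → ∀ j k → j ≢ k →
    Avoids (toℕ j) x₁ x₂ x₃ x₄ → Avoids (toℕ k) x₁ x₂ x₃ x₄ → ⊥
  P4-meets-A-edge p j k j≢k (j₁ , j₂ , j₃ , j₄) (k₁ , k₂ , k₃ , k₄) =
    P2∪P4-free⇒no-edge-anticomplete-to-P4 G P2∪P4-free (a-adj j≢k) (P4⇒induced p)
      (misses j j₁ , misses j j₂ , misses j j₃ , misses j j₄)
      (misses k k₁ , misses k k₂ , misses k k₃ , misses k k₄)

  data Among (c : Vec ℕ 3) (x : H) : Set where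
    unclassified : 5 ≤ class x → Among c x
    at           : ∀ i → class x ≡ lookup c i → Among c x

  P4-not-among-three : ∀ {x₁ x₂ x₃ x₄} → P4 x₁ x₂ x₃ x₄ → ∀ c →
    Among c x₁ → Among c x₂ → Among c x₃ → Among c x₄ → ⊥
  P4-not-among-three p c m₁ m₂ m₃ m₄ =
    let j , k , j≢k , c≢j , c≢k = two-uncovered c in
    P4-meets-A-edge p j k j≢k (avoid m₁ c≢j , avoid m₂ c≢j , avoid m₃ c≢j , avoid m₄ c≢j)
                              (avoid m₁ c≢k , avoid m₂ c≢k , avoid m₃ c≢k , avoid m₄ c≢k)
    where
    avoid : ∀ {x j} → Among c x → (∀ i → lookup c i ≢ toℕ j) → class x ≢ toℕ j
    avoid {j = j} (unclassified 5≤) _ eq = <⇒≱ (toℕ<n j) (subst (5 ≤_) eq 5≤)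
    avoid (at i eq) c≢ eq′ = c≢ i (trans (sym eq) eq′)

  P4-classes-distinct : ∀ {x₁ x₂ x₃ x₄} → P4 x₁ x₂ x₃ x₄ → AllDistinct (class x₁) (class x₂) (class x₃) (class x₄)
  P4-classes-distinct {x₁} {x₂} {x₃} {x₄} p = record
    { c₁≢c₂ = λ eq → among (c₁ ∷ c₃ ∷ c₄ ∷ []) (at 0F refl) (at 0F (sym eq)) (at 1F refl) (at 2F refl)
    ; c₁≢c₃ = λ eq → among (c₁ ∷ c₂ ∷ c₄ ∷ []) (at 0F refl) (at 1F refl) (at 0F (sym eq)) (at 2F refl)
    ; c₁≢c₄ = λ eq → among (c₁ ∷ c₂ ∷ c₃ ∷ []) (at 0F refl) (at 1F refl) (at 2F refl) (at 0F (sym eq))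
    ; c₂≢c₃ = λ eq → among (c₁ ∷ c₂ ∷ c₄ ∷ []) (at 0F refl) (at 1F refl) (at 1F (sym eq)) (at 2F refl)
    ; c₂≢c₄ = λ eq → among (c₁ ∷ c₂ ∷ c₃ ∷ []) (at 0F refl) (at 1F refl) (at 2F refl) (at 1F (sym eq))
    ; c₃≢c₄ = λ eq → among (c₁ ∷ c₂ ∷ c₃ ∷ []) (at 0F refl) (at 1F refl) (at 2F refl) (at 2F (sym eq))
    }
    where
    among = P4-not-among-three p
    c₁ = class x₁
    c₂ = class x₂
    c₃ = class x₃
    c₄ = class x₄

  record FirstFitColouring (Done : Fin n → Set) : Set where
    field
      colour    : Fin n → ℕ
      a-done    : ∀ k → Done (a k)
      colour-a  : ∀ k → colour (a k) ≡ toℕ k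
      colour<5  : ∀ {y} → Done y → colour y ℕ.< 5
      proper    : ∀ {x y} → Done x → Done y → adj G x y ≡ true → colour x ≢ colour y
      -- a witness of colour t in A can only be aₜ, and then class x ≡ t
      first-fit : ∀ {x : H} {t} → Done (value x) → t ℕ.< colour (value x) →
                  class x ≡ t ⊎ ∃ λ w → Done (value w) × x ~ w × colour (value w) ≡ t × class w ≤ class x

  module FirstFit {Done : Fin n → Set} (χ : FirstFitColouring Done) where
    open FirstFitColouring χ

    record Col (t : ℕ) (x : H) : Set where
      constructor coloured
      field
        done    : Done (value x)
        colour≡ : colour (value x) ≡ t
    open Col

    same-colour⇒≁ : ∀ {t x y} → Col t x → Col t y → x ≁ y
    same-colour⇒≁ {x = x} {y} x-col y-col with ~? x y
    ... | inj₁ (edge xy) = contradiction (trans (colour≡ x-col) (sym (colour≡ y-col)))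
                                         (proper (done x-col) (done y-col) xy)
    ... | inj₂ x≁y = x≁y

    colours-differ : ∀ {s t x y} → Col s x → Col t y → {False (s ℕ.≟ t)} → x ≢ y
    colours-differ x-col y-col {s≢t} refl = toWitnessFalse s≢t (trans (sym (colour≡ x-col)) (colour≡ y-col))

    ≁-off-triangle : ∀ {s t x y p q} → x ~ y → x ~ p → y ~ p → x ~ q → Col s p → Col t q →
      {False (s ℕ.≟ t)} → y ≁ q
    ≁-off-triangle {y = y} {q = q} xy xp yp xq p-col q-col {s≢t} with ~? y q
    ... | inj₁ yq = ⊥-elim (colours-differ p-col q-col {s≢t} (edge-in-one-triangle xy xp yp xq yq))
    ... | inj₂ y≁q = y≁q

    colour≢class : ∀ {t x} → Col t x → class x ≢ t
    colour≢class x-col refl = proper (done x-col) (a-done k) (adjacentᴬ (class⇒~ᴬ k (sym (toℕ-fromℕ< _))))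
      (trans (colour≡ x-col) (trans (sym (toℕ-fromℕ< _)) (sym (colour-a k))))
      where k = fromℕ< (subst (ℕ._< 5) (colour≡ x-col) (colour<5 (done x-col)))

    witness : ∀ {c t x} → Col c x → t ℕ.< c → class x ≡ t ⊎ ∃ λ w → Col t w × x ~ w × class w ≤ class x
    witness x-col t<c = Sum.map₂ (λ (w , w-done , xw , w-colour , w≤x) → w , coloured w-done w-colour , xw , w≤x)
      (first-fit (done x-col) (subst (_ ℕ.<_) (sym (colour≡ x-col)) t<c))

    module Around (v : H) (v-last : ∀ {t x} → Col t x → class x ≤ class v)
      (v-sees : ∀ {t} → t ℕ.< 5 → ∃ λ y → Done y × adj G (value v) y ≡ true × colour y ≡ t) where

      neighbour-of-colour : ∀ {t} → t ℕ.< 5 → class v ≢ t → ∃ λ x → Col t x × v ~ x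
      neighbour-of-colour t<5 v∉Bt with v-sees t<5
      ... | y , y-done , vy , y-colour with y ∈? A
      ...   | no y∉A = (y , [ y∉A ]) , coloured y-done y-colour , edge vy
      ...   | yes y∈A with A⊆a y∈A
      ...     | k , refl = ⊥-elim (v∉Bt (trans (~ᴬ⇒class (edgeᴬ vy)) (trans (sym (colour-a k)) y-colour)))

      Partner : H → ℕ → Set
      Partner x s = ∃ λ p → Col s p × v ~ p × x ~ p

      one-partner : ∀ {x s s′} → v ~ x → Partner x s → Partner x s′ → s ≡ s′
      one-partner vx (p , p-col , vp , xp) (q , q-col , vq , xq) with edge-in-one-triangle vx vp xp vq xq
      ... | refl = trans (sym (colour≡ p-col)) (colour≡ q-col)

      Settled : H → ℕ → Set
      Settled x s = class x ≡ s ⊎ Partner x s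

      three-settled : ∀ {x s₁ s₂ s₃} → v ~ x → s₁ ≢ s₂ → s₁ ≢ s₃ → s₂ ≢ s₃ →
        Settled x s₁ → Settled x s₂ → Settled x s₃ → ⊥
      three-settled vx s₁≢s₂ _ _ (inj₁ x∈B₁) (inj₁ x∈B₂) _ = s₁≢s₂ (trans (sym x∈B₁) x∈B₂)
      three-settled vx _ s₁≢s₃ _ (inj₁ x∈B₁) _ (inj₁ x∈B₃) = s₁≢s₃ (trans (sym x∈B₁) x∈B₃)
      three-settled vx _ _ s₂≢s₃ _ (inj₁ x∈B₂) (inj₁ x∈B₃) = s₂≢s₃ (trans (sym x∈B₂) x∈B₃)
      three-settled vx s₁≢s₂ _ _ (inj₂ p₁) (inj₂ p₂) _ = s₁≢s₂ (one-partner vx p₁ p₂)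
      three-settled vx _ s₁≢s₃ _ (inj₂ p₁) _ (inj₂ p₃) = s₁≢s₃ (one-partner vx p₁ p₃)
      three-settled vx _ _ s₂≢s₃ _ (inj₂ p₂) (inj₂ p₃) = s₂≢s₃ (one-partner vx p₂ p₃)

      record Detour (x xs : H) (s : ℕ) : Set where
        field
          w     : H
          w-col : Col s w
          w≤x   : class w ≤ class x
          x∉Bs  : class x ≢ s
          path  : P4 xs v x w

      outcome : ∀ {c s x xs} → Col c x → v ~ x → Col s xs → v ~ xs → s ℕ.< c → Settled x s ⊎ Detour x xs s
      outcome {s = s} {x} {xs} x-col vx xs-col vxs s<c with class x ℕ.≟ s | witness x-col s<c
      ... | yes x∈Bs | _ = inj₁ (inj₁ x∈Bs)
      ... | no _ | inj₁ x∈Bs = inj₁ (inj₁ x∈Bs)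
      ... | no x∉Bs | inj₂ (w , w-col , xw , w≤x) with ~? v w | ~? xs x
      ...   | inj₁ vw | _ = inj₁ (inj₂ (w , w-col , vw , xw))
      ...   | inj₂ _ | inj₁ xsx = inj₁ (inj₂ (xs , xs-col , vxs , ~-sym xsx))
      ...   | inj₂ v≁w | inj₂ xs≁x = inj₂ (record
              { w = w ; w-col = w-col ; w≤x = w≤x ; x∉Bs = x∉Bs
              ; path = p4 (~-sym vxs) vx xw xs≁x (same-colour⇒≁ xs-col w-col) v≁w })

      -- x₄ is settled at the three colours s < 4 other than class v: on a detour no vertex would be
      -- in B₄ or Bₛ, or v would have no class at all.
      ¬v∉B₄ : ¬ class v ≢ 4
      ¬v∉B₄ v∉B₄ with neighbour-of-colour {4} ≤-refl v∉B₄
      ... | x₄ , x₄-col , vx₄ = in-class (class v) refl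
        where
        no-detour : ∀ {s xs} → Col (toℕ s) xs → class v ≢ toℕ s → toℕ s ℕ.< 4 → Detour x₄ xs (toℕ s) → ⊥
        no-detour {s} {xs} xs-col v∉Bs s<4 d with class v ℕ.≟ 5
        ... | yes v∈B₅ = P4-not-among-three path (class xs ∷ class x₄ ∷ class w ∷ [])
                           (at 0F refl) (unclassified (subst (5 ≤_) (sym v∈B₅) ≤-refl)) (at 1F refl) (at 2F refl)
          where open Detour d
        ... | no v∉B₅ = P4-meets-A-edge path 4F s (λ 4≡s → <⇒≢ s<4 (cong toℕ (sym 4≡s)))
              (below-4 (v-last xs-col) , v∉B₄ , below-4 (v-last x₄-col) , below-4 (≤-trans w≤x (v-last x₄-col)))
              (colour≢class xs-col , v∉Bs , x∉Bs , colour≢class w-col)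
          where
          open Detour d
          below-4 : ∀ {c} → c ≤ class v → c ≢ 4
          below-4 c≤v = <⇒≢ (≤-<-trans c≤v (≤∧≢⇒< (≤-pred (≤∧≢⇒< (class≤5 v) v∉B₅)) v∉B₄))
        settled : ∀ s {_ : True (toℕ s ℕ.<? 4)} → class v ≢ toℕ s → Settled x₄ (toℕ s)
        settled s {s<4?} v∉Bs with neighbour-of-colour (toℕ<n s) v∉Bs
        ... | xs , xs-col , vxs =
          [ id , ⊥-elim ∘ no-detour xs-col v∉Bs (toWitness s<4?) ]′
            (outcome x₄-col vx₄ xs-col vxs (toWitness s<4?))
        in-class : ∀ c → class v ≡ c → ⊥
        in-class 0 v∈B₀ = three-settled vx₄ (λ ()) (λ ()) (λ ())
          (settled 1F (class≢ v∈B₀)) (settled 2F (class≢ v∈B₀)) (settled 3F (class≢ v∈B₀))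
        in-class 1 v∈B₁ = three-settled vx₄ (λ ()) (λ ()) (λ ())
          (settled 0F (class≢ v∈B₁)) (settled 2F (class≢ v∈B₁)) (settled 3F (class≢ v∈B₁))
        in-class 2 v∈B₂ = three-settled vx₄ (λ ()) (λ ()) (λ ())
          (settled 0F (class≢ v∈B₂)) (settled 1F (class≢ v∈B₂)) (settled 3F (class≢ v∈B₂))
        in-class 3 v∈B₃ = three-settled vx₄ (λ ()) (λ ()) (λ ())
          (settled 0F (class≢ v∈B₃)) (settled 1F (class≢ v∈B₃)) (settled 2F (class≢ v∈B₃))
        in-class 4 v∈B₄ = v∉B₄ v∈B₄
        in-class (suc (suc (suc (suc (suc _))))) v∈B₅ = three-settled vx₄ (λ ()) (λ ()) (λ ())
          (settled 0F (class≢ v∈B₅)) (settled 1F (class≢ v∈B₅)) (settled 2F (class≢ v∈B₅))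

      -- The hard case: the colour-4 neighbour of v may be a₄ itself, so x₃ takes the role of x₄.
      module InB₄ (v∈B₄ : class v ≡ 4) where

        v-neighbour : ∀ t {_ : True (t ℕ.<? 4)} → ∃ λ x → Col t x × v ~ x
        v-neighbour t {t<4?} = neighbour-of-colour (<-trans (toWitness t<4?) ≤-refl)
                                 λ v∈Bt → <⇒≢ (toWitness t<4?) (trans (sym v∈Bt) v∈B₄)

        class≤4 : ∀ {t x} → Col t x → class x ≤ 4
        class≤4 x-col = subst (_ ≤_) v∈B₄ (v-last x-col)

        by-class : ∀ {R : Set} {t x} → Col t x → (∀ c → c ≤ 4 → class x ≡ c → R) → R
        by-class x-col k = k _ (class≤4 x-col) refl

        in-B₁ : ∀ {x u} → class x ≡ 1 → Col 0 u → class u ≤ class x → class u ≡ 1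
        in-B₁ x∈B₁ u-col u≤x = ≤1∧≢0⇒≡1 (subst (_ ≤_) x∈B₁ u≤x) (colour≢class u-col)

        v-sees-no-edge-in : ∀ {x y} k {_ : False (toℕ k ℕ.≟ 4)} →
          x ~ y → class x ≡ toℕ k → class y ≡ toℕ k → v ~ x → v ~ y → ⊥
        v-sees-no-edge-in k {k≢4} xy x∈Bk y∈Bk vx vy =
          toWitnessFalse k≢4 (trans (sym (same-class-closed k xy x∈Bk y∈Bk vx vy)) v∈B₄)

        record DetourShape (x₃ xs w : H) : Set where
          field
            xs∈B₃ : class xs ≡ 3
            w<x₃  : class w ℕ.< class x₃
            x₃<3  : class x₃ ℕ.< 3

        detour-shape : ∀ {x₃ xs} s {_ : True (toℕ s ℕ.<? 3)} → Col 3 x₃ → Col (toℕ s) xs →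
          (d : Detour x₃ xs (toℕ s)) → DetourShape x₃ xs (Detour.w d)
        detour-shape {x₃} {xs} s {s<3?} x₃-col xs-col d = record { xs∈B₃ = xs∈B₃ ; w<x₃ = w<x₃ ; x₃<3 = x₃<3 }
          where
          open Detour d
          s<3 = toWitness s<3?
          x₃<3 : class x₃ ℕ.< 3
          x₃<3 = ≤∧≢⇒< (≤-pred (≤∧≢⇒< (class≤4 x₃-col)
                   (λ x₃∈B₄ → c₂≢c₃ (P4-classes-distinct path) (trans v∈B₄ (sym x₃∈B₄))))) (colour≢class x₃-col)
          w<x₃ : class w ℕ.< class x₃
          w<x₃ = ≤∧≢⇒< w≤x (c₃≢c₄ (P4-classes-distinct path) ∘ sym)
          xs∈B₃ : class xs ≡ 3
          xs∈B₃ = decidable-stable (class xs ℕ.≟ 3) λ xs∉B₃ → P4-meets-A-edge path 3F s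
            (λ 3≡s → <⇒≢ s<3 (cong toℕ (sym 3≡s)))
            (xs∉B₃ , class≢ v∈B₄ , colour≢class x₃-col , <⇒≢ (<-trans w<x₃ x₃<3))
            (colour≢class xs-col , (λ v∈Bs → <⇒≢ (<-trans s<3 ≤-refl) (trans (sym v∈Bs) v∈B₄))
            , x∉Bs , colour≢class w-col)

        detour₀-w∈B₁ : ∀ {x₃ x₀} → Col 3 x₃ → class x₃ ≡ 2 → Col 0 x₀ →
          (d : Detour x₃ x₀ 0) → class (Detour.w d) ≡ 1
        detour₀-w∈B₁ x₃-col x₃∈B₂ x₀-col d = ≤1∧≢0⇒≡1
          (≤-pred (subst (_ ℕ.<_) x₃∈B₂ (DetourShape.w<x₃ (detour-shape 0F x₃-col x₀-col d))))
          (colour≢class (Detour.w-col d))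

        detour₁-w∈B₀ : ∀ {x₃ x₁} → Col 3 x₃ → class x₃ ≡ 2 → Col 1 x₁ →
          (d : Detour x₃ x₁ 1) → class (Detour.w d) ≡ 0
        detour₁-w∈B₀ x₃-col x₃∈B₂ x₁-col d = n<1⇒n≡0 (≤∧≢⇒<
          (≤-pred (subst (_ ℕ.<_) x₃∈B₂ (DetourShape.w<x₃ (detour-shape 1F x₃-col x₁-col d))))
          (colour≢class (Detour.w-col d)))

        x₂∉B₀ : ∀ {x₂ z} → Col 2 x₂ → v ~ x₂ → class x₂ ≡ 0 → Col 1 z → v ~ z → z ≁ x₂ → ⊥
        x₂∉B₀ x₂-col vx₂ x₂∈B₀ z-col vz z≁x₂ with witness {t = 1} x₂-col ≤-refl
        ... | inj₁ x₂∈B₁ = class≢ x₂∈B₀ x₂∈B₁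
        ... | inj₂ (u , u-col , x₂u , u≤x₂) with ~? v u
        ...   | inj₁ vu = v-sees-no-edge-in 0F x₂u x₂∈B₀ u∈B₀ vx₂ vu
          where u∈B₀ = n≤0⇒n≡0 (subst (_ ≤_) x₂∈B₀ u≤x₂)
        ...   | inj₂ v≁u = c₃≢c₄ (P4-classes-distinct (p4 (~-sym vz) vx₂ x₂u z≁x₂ (same-colour⇒≁ z-col u-col) v≁u))
                  (trans x₂∈B₀ (sym (n≤0⇒n≡0 (subst (_ ≤_) x₂∈B₀ u≤x₂))))

        x₂∉B₁ : ∀ {x₂ z} → Col 2 x₂ → v ~ x₂ → class x₂ ≡ 1 → Col 0 z → v ~ z → z ≁ x₂ → ⊥
        x₂∉B₁ x₂-col vx₂ x₂∈B₁ z-col vz z≁x₂ with witness {t = 0} x₂-col (s≤s z≤n)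
        ... | inj₁ x₂∈B₀ = class≢ x₂∈B₁ x₂∈B₀
        ... | inj₂ (u , u-col , x₂u , u≤x₂) with ~? v u
        ...   | inj₁ vu = v-sees-no-edge-in 1F x₂u x₂∈B₁ u∈B₁ vx₂ vu
          where u∈B₁ = in-B₁ x₂∈B₁ u-col u≤x₂
        ...   | inj₂ v≁u = c₃≢c₄ (P4-classes-distinct (p4 (~-sym vz) vx₂ x₂u z≁x₂ (same-colour⇒≁ z-col u-col) v≁u))
                  (trans x₂∈B₁ (sym (in-B₁ x₂∈B₁ u-col u≤x₂)))

        x₂∉B₄ : ∀ {x₂ z₀ z₁} → Col 2 x₂ → v ~ x₂ → class x₂ ≡ 4 →
          Col 0 z₀ → v ~ z₀ → z₀ ≁ x₂ → Col 1 z₁ → v ~ z₁ → z₁ ≁ x₂ → ⊥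
        x₂∉B₄ x₂-col vx₂ x₂∈B₄ z₀-col vz₀ z₀≁x₂ z₁-col vz₁ z₁≁x₂
          with witness {t = 0} x₂-col (s≤s z≤n) | witness {t = 1} x₂-col ≤-refl
        ... | inj₁ x₂∈B₀ | _ = class≢ x₂∈B₄ x₂∈B₀
        ... | _ | inj₁ x₂∈B₁ = class≢ x₂∈B₄ x₂∈B₁
        ... | inj₂ (u₀ , u₀-col , x₂u₀ , _) | inj₂ (u₁ , u₁-col , x₂u₁ , _) with ~? v u₀
        ...   | inj₁ vu₀ = collision (p4 (~-sym vz₁) vx₂ x₂u₁ z₁≁x₂ (same-colour⇒≁ z₁-col u₁-col)
                                         (≁-off-triangle (~-sym vx₂) x₂u₀ vu₀ x₂u₁ u₀-col u₁-col))
          where collision = λ path → c₂≢c₃ (P4-classes-distinct path) (trans v∈B₄ (sym x₂∈B₄))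
        ...   | inj₂ v≁u₀ = collision (p4 (~-sym vz₀) vx₂ x₂u₀ z₀≁x₂ (same-colour⇒≁ z₀-col u₀-col) v≁u₀)
          where collision = λ path → c₂≢c₃ (P4-classes-distinct path) (trans v∈B₄ (sym x₂∈B₄))

        y∉B₃ : ∀ {x₃ xs y c} s {_ : True (toℕ s ℕ.<? 2)} {_ : True (toℕ s ℕ.<? c)} {_ : False (c ℕ.≟ 3)} →
          Col 3 x₃ → class x₃ ≡ 2 → Col (toℕ s) xs → class xs ≡ 3 →
          (d : Detour x₃ xs (toℕ s)) → class (Detour.w d) ≢ 3 → Col c y → v ~ y → class y ≡ 3 → ⊥
        y∉B₃ {x₃} {xs} {y} s {s<2?} {s<c?} {c≢3} x₃-col x₃∈B₂ xs-col xs∈B₃ d w∉B₃ y-col vy y∈B₃ = via-u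
          where
          open Detour d
          open P4 path renaming (x₁x₂ to xsv; x₂x₃ to vx₃; x₃x₄ to x₃w; x₂x₄ to v≁w)
          s<2 = toWitness s<2?
          u∈B₃ : ∀ {u} → Col (toℕ s) u → y ~ u → v ~ u → class u ≡ 3
          u∈B₃ {u} u-col yu vu = decidable-stable (class u ℕ.≟ 3) λ u∉B₃ →
            P4-meets-A-edge (p4 (~-sym vu) vx₃ x₃w (≁-off-triangle vu vy (~-sym yu) vx₃ y-col x₃-col {c≢3})
                                (same-colour⇒≁ u-col w-col) v≁w) s 3F
              (λ s≡3 → <⇒≢ (<-trans s<2 ≤-refl) (cong toℕ s≡3))
              (colour≢class u-col , (λ v∈Bs → <⇒≢ (<-trans s<2 (s≤s (s≤s (s≤s z≤n)))) (trans (sym v∈Bs) v∈B₄))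
              , (λ x₃∈Bs → <⇒≢ s<2 (trans (sym x₃∈Bs) x₃∈B₂)) , colour≢class w-col)
              (u∉B₃ , class≢ v∈B₄ , class≢ x₃∈B₂ , w∉B₃)
          via-u : ⊥
          via-u with ~? xs y | witness {t = toℕ s} y-col (toWitness s<c?)
          ... | inj₁ xsy | _ = v-sees-no-edge-in 3F xsy xs∈B₃ y∈B₃ (~-sym xsv) vy
          ... | _ | inj₁ y∈Bs = <⇒≢ (<-trans s<2 ≤-refl) (trans (sym y∈Bs) y∈B₃)
          ... | inj₂ xs≁y | inj₂ (u , u-col , yu , _) with ~? v u
          ...   | inj₁ vu = v-sees-no-edge-in 3F yu y∈B₃ (u∈B₃ u-col yu vu) vy vu
          ...   | inj₂ v≁u =
            c₁≢c₃ (P4-classes-distinct (p4 xsv vy yu xs≁y (same-colour⇒≁ xs-col u-col) v≁u))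
                  (trans xs∈B₃ (sym y∈B₃))

        module Partner₀Detour₂ {x₃ p x₂} (x₃-col : Col 3 x₃) (vx₃ : v ~ x₃) (x₃∈B₁ : class x₃ ≡ 1)
          (p-col : Col 0 p) (vp : v ~ p) (x₃p : x₃ ~ p) (x₂-col : Col 2 x₂) (d : Detour x₃ x₂ 2)
          (x₂∈B₃ : class x₂ ≡ 3) (w∈B₀ : class (Detour.w d) ≡ 0) where
          open Detour d
          open P4 path renaming (x₁x₂ to x₂v; x₃x₄ to x₃w; x₁x₃ to x₂≁x₃; x₁x₄ to x₂≁w; x₂x₄ to v≁w)

          p≁x₂ : p ≁ x₂
          p≁x₂ = ≁-off-triangle vp vx₃ (~-sym x₃p) (~-sym x₂v) x₃-col x₂-col

          y-x₂-v-p : ∀ {y} → Col 0 y → x₃ ~ y → class y ≡ 1 → y ~ x₂ → v ≁ y → ⊥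
          y-x₂-v-p {y} y-col x₃y y∈B₁ yx₂ v≁y with ~? w y | ~? w p
          ... | inj₁ wy | _ = class≢ w∈B₀ (same-class-closed 1F x₃y x₃∈B₁ y∈B₁ (~-sym x₃w) wy)
          ... | inj₂ _ | inj₁ wp =
            ~⇒¬≁ x₂v (subst (x₂ ≁_) (sym (edge-in-one-triangle x₃p (~-sym vx₃) (~-sym vp) x₃w (~-sym wp))) x₂≁w)
          ... | inj₂ w≁y | inj₂ w≁p = P4-meets-edge-to-A (class⇒~ᴬ 0F w∈B₀) path′ w≁y (≁-sym x₂≁w) (≁-sym v≁w) w≁p
                (class≢ y∈B₁ , class≢ x₂∈B₃ , class≢ v∈B₄ , class≢ p∈B₂)
            where
            path′ : P4 y x₂ v p
            path′ = p4 yx₂ x₂v vp (≁-sym v≁y) (same-colour⇒≁ y-col p-col) (≁-sym p≁x₂)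
            p∈B₂ : class p ≡ 2
            p∈B₂ = decidable-stable (class p ℕ.≟ 2) λ p∉B₂ → P4-meets-A-edge path′ 0F 2F (λ ())
              (class≢ y∈B₁ , class≢ x₂∈B₃ , class≢ v∈B₄ , colour≢class p-col)
              (class≢ y∈B₁ , class≢ x₂∈B₃ , class≢ v∈B₄ , p∉B₂)

          absurd : ⊥
          absurd with witness {t = 0} x₃-col (s≤s z≤n)
          ... | inj₁ x₃∈B₀ = class≢ x₃∈B₁ x₃∈B₀
          ... | inj₂ (y , y-col , x₃y , y≤x₃) with ~? v y | ~? y x₂
          ...   | inj₁ vy | _ = v-sees-no-edge-in 1F x₃y x₃∈B₁ y∈B₁ vx₃ vy
            where y∈B₁ = in-B₁ x₃∈B₁ y-col y≤x₃
          ...   | inj₂ v≁y | inj₁ yx₂ = y-x₂-v-p y-col x₃y (in-B₁ x₃∈B₁ y-col y≤x₃) yx₂ v≁y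
          ...   | inj₂ v≁y | inj₂ y≁x₂ =
            c₁≢c₂ (P4-classes-distinct (p4 (~-sym x₃y) (~-sym vx₃) (~-sym x₂v) (≁-sym v≁y) y≁x₂ (≁-sym x₂≁x₃)))
                  (trans (in-B₁ x₃∈B₁ y-col y≤x₃) (sym x₃∈B₁))

        x₃∉B₁ : ∀ {x₃} → Col 3 x₃ → v ~ x₃ → class x₃ ≡ 1 → ⊥
        x₃∉B₁ {x₃} x₃-col vx₃ x₃∈B₁ with v-neighbour 0 | v-neighbour 2
        ... | x₀ , x₀-col , vx₀ | x₂ , x₂-col , vx₂
          with outcome x₃-col vx₃ x₀-col vx₀ (s≤s z≤n) | outcome x₃-col vx₃ x₂-col vx₂ (s≤s (s≤s (s≤s z≤n)))
        ... | inj₁ (inj₁ x₃∈B₀) | _ = class≢ x₃∈B₁ x₃∈B₀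
        ... | _ | inj₁ (inj₁ x₃∈B₂) = class≢ x₃∈B₁ x₃∈B₂
        ... | inj₂ d₀ | _ = colour≢class (Detour.w-col d₀)
          (n<1⇒n≡0 (subst (_ ℕ.<_) x₃∈B₁ (DetourShape.w<x₃ (detour-shape 0F x₃-col x₀-col d₀))))
        ... | inj₁ (inj₂ p₀) | inj₁ (inj₂ p₂) = contradiction (one-partner vx₃ p₀ p₂) λ ()
        ... | inj₁ (inj₂ (p , p-col , vp , x₃p)) | inj₂ d₂ = Partner₀Detour₂.absurd
          x₃-col vx₃ x₃∈B₁ p-col vp x₃p x₂-col d₂ (DetourShape.xs∈B₃ shape)
          (n<1⇒n≡0 (subst (_ ℕ.<_) x₃∈B₁ (DetourShape.w<x₃ shape)))
          where shape = detour-shape 2F x₃-col x₂-col d₂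

        module Partner₀Detour₁ {x₃ p x₁} (x₃-col : Col 3 x₃) (vx₃ : v ~ x₃) (x₃∈B₂ : class x₃ ≡ 2)
          (p-col : Col 0 p) (vp : v ~ p) (x₃p : x₃ ~ p) (x₁-col : Col 1 x₁) (d : Detour x₃ x₁ 1)
          (x₁∈B₃ : class x₁ ≡ 3) (w∈B₀ : class (Detour.w d) ≡ 0) where
          open Detour d
          open P4 path renaming (x₁x₂ to x₁v; x₃x₄ to x₃w; x₁x₃ to x₁≁x₃; x₁x₄ to x₁≁w; x₂x₄ to v≁w)

          vx₁ : v ~ x₁
          vx₁ = ~-sym x₁v

          p≁x₁ : p ≁ x₁
          p≁x₁ = ≁-off-triangle vp vx₃ (~-sym x₃p) vx₁ x₃-col x₁-col

          p∈B₁⊎B₃ : class p ≡ 1 ⊎ class p ≡ 3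
          p∈B₁⊎B₃ = by-class p-col λ where
            0 _ p∈B₀ → ⊥-elim (colour≢class p-col p∈B₀)
            1 _ p∈B₁ → inj₁ p∈B₁
            2 _ p∈B₂ → ⊥-elim (v-sees-no-edge-in 2F x₃p x₃∈B₂ p∈B₂ vx₃ vp)
            3 _ p∈B₃ → inj₂ p∈B₃
            4 _ p∈B₄ → ⊥-elim (class≢ x₃∈B₂ (same-class-closed 4F vp v∈B₄ p∈B₄ (~-sym vx₃) x₃p))
            (suc (suc (suc (suc (suc _))))) (s≤s (s≤s (s≤s (s≤s ())))) _

          q-on-v : ∀ {q} → Col 0 q → x₁ ~ q → v ~ q → ⊥
          q-on-v q-col x₁q vq with v-neighbour 2
          ... | x₂ , x₂-col , vx₂ = by-class x₂-col λ where
              0 _ x₂∈B₀ → x₂∉B₀ x₂-col vx₂ x₂∈B₀ x₁-col vx₁ x₁≁x₂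
              1 _ x₂∈B₁ → x₂∉B₁ x₂-col vx₂ x₂∈B₁ p-col vp p≁x₂
              2 _ x₂∈B₂ → colour≢class x₂-col x₂∈B₂
              3 _ x₂∈B₃ → y∉B₃ 1F x₃-col x₃∈B₂ x₁-col x₁∈B₃ d (class≢ w∈B₀) x₂-col vx₂ x₂∈B₃
              4 _ x₂∈B₄ → x₂∉B₄ x₂-col vx₂ x₂∈B₄ p-col vp p≁x₂ x₁-col vx₁ x₁≁x₂
              (suc (suc (suc (suc (suc _))))) (s≤s (s≤s (s≤s (s≤s ())))) _
            where
            x₁≁x₂ = ≁-off-triangle vx₁ vq x₁q vx₂ q-col x₂-col
            p≁x₂ = ≁-off-triangle vp vx₃ (~-sym x₃p) vx₂ x₃-col x₂-col

          q-off-v : ∀ {q} → Col 0 q → x₁ ~ q → v ≁ q → class p ≡ 1 → ⊥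
          q-off-v {q} q-col x₁q v≁q p∈B₁ = via-w
            where
            path′ : P4 p v x₁ q
            path′ = p4 (~-sym vp) vx₁ x₁q p≁x₁ (same-colour⇒≁ p-col q-col) v≁q
            q∈B₂ : class q ≡ 2
            q∈B₂ = decidable-stable (class q ℕ.≟ 2) λ q∉B₂ → P4-meets-A-edge path′ 0F 2F (λ ())
              (class≢ p∈B₁ , class≢ v∈B₄ , class≢ x₁∈B₃ , colour≢class q-col)
              (class≢ p∈B₁ , class≢ v∈B₄ , class≢ x₁∈B₃ , q∉B₂)
            via-w : ⊥
            via-w with ~? w p | ~? w q | ~? q x₃
            ... | inj₁ wp | _ | _ =
              ~⇒¬≁ x₁v (subst (x₁ ≁_) (sym (edge-in-one-triangle x₃p (~-sym vx₃) (~-sym vp) x₃w (~-sym wp))) x₁≁w)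
            ... | inj₂ w≁p | inj₂ w≁q | _ =
              P4-meets-edge-to-A (class⇒~ᴬ 0F w∈B₀) path′ w≁p (≁-sym v≁w) (≁-sym x₁≁w) w≁q
                (class≢ p∈B₁ , class≢ v∈B₄ , class≢ x₁∈B₃ , class≢ q∈B₂)
            ... | inj₂ _ | inj₁ wq | inj₁ qx₃ =
              class≢ w∈B₀ (same-class-closed 2F (~-sym qx₃) x₃∈B₂ q∈B₂ (~-sym x₃w) wq)
            ... | inj₂ _ | inj₁ _ | inj₂ q≁x₃ =
              c₁≢c₄ (P4-classes-distinct (p4 (~-sym x₁q) x₁v vx₃ (≁-sym v≁q) q≁x₃ x₁≁x₃)) (trans q∈B₂ (sym x₃∈B₂))

          absurd : ⊥
          absurd with witness {t = 0} x₁-col (s≤s z≤n)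
          ... | inj₁ x₁∈B₀ = class≢ x₁∈B₃ x₁∈B₀
          ... | inj₂ (q , q-col , x₁q , _) with ~? v q | p∈B₁⊎B₃
          ...   | inj₁ vq | _ = q-on-v q-col x₁q vq
          ...   | inj₂ v≁q | inj₁ p∈B₁ = q-off-v q-col x₁q v≁q p∈B₁
          ...   | inj₂ v≁q | inj₂ p∈B₃ =
            c₁≢c₃ (P4-classes-distinct (p4 (~-sym vp) vx₁ x₁q p≁x₁ (same-colour⇒≁ p-col q-col) v≁q))
                  (trans p∈B₃ (sym x₁∈B₃))

        module Detour₀Partner₁ {x₃ x₀ p} (x₃-col : Col 3 x₃) (vx₃ : v ~ x₃) (x₃∈B₂ : class x₃ ≡ 2)
          (x₀-col : Col 0 x₀) (d : Detour x₃ x₀ 0) (x₀∈B₃ : class x₀ ≡ 3) (w∈B₁ : class (Detour.w d) ≡ 1)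
          (p-col : Col 1 p) (vp : v ~ p) (x₃p : x₃ ~ p) where
          open Detour d
          open P4 path renaming (x₁x₂ to x₀v)

          vx₀ : v ~ x₀
          vx₀ = ~-sym x₀v

          x₂∉B₁′ : ∀ {x₂} → Col 2 x₂ → v ~ x₂ → class x₂ ≡ 1 → ⊥
          x₂∉B₁′ x₂-col vx₂ x₂∈B₁ with witness {t = 0} x₂-col (s≤s z≤n)
          ... | inj₁ x₂∈B₀ = class≢ x₂∈B₁ x₂∈B₀
          ... | inj₂ (u , u-col , x₂u , u≤x₂) with ~? v u | ~? u x₃ | ~? u p
          ...   | inj₁ vu | _ | _ = v-sees-no-edge-in 1F x₂u x₂∈B₁ u∈B₁ vx₂ vu
            where u∈B₁ = in-B₁ x₂∈B₁ u-col u≤x₂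
          ...   | inj₂ v≁u | inj₂ u≁x₃ | _ =
            c₁≢c₂ (P4-classes-distinct (p4 (~-sym x₂u) (~-sym vx₂) vx₃ (≁-sym v≁u) u≁x₃
                                  (≁-sym (≁-off-triangle vx₃ vp x₃p vx₂ p-col x₂-col))))
                  (trans (in-B₁ x₂∈B₁ u-col u≤x₂) (sym x₂∈B₁))
          ...   | inj₂ v≁u | _ | inj₂ u≁p =
            c₁≢c₂ (P4-classes-distinct (p4 (~-sym x₂u) (~-sym vx₂) vp (≁-sym v≁u) u≁p
                                  (≁-sym (≁-off-triangle vp vx₃ (~-sym x₃p) vx₂ x₃-col x₂-col))))
                  (trans (in-B₁ x₂∈B₁ u-col u≤x₂) (sym x₂∈B₁))
          ...   | inj₂ v≁u | inj₁ ux₃ | inj₁ up = ~⇒¬≁ x₀v (subst (x₀ ≁_) (sym v≡u) (same-colour⇒≁ x₀-col u-col))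
            where v≡u = edge-in-one-triangle x₃p (~-sym vx₃) (~-sym vp) (~-sym ux₃) (~-sym up)

          absurd : ⊥
          absurd with v-neighbour 2
          ... | x₂ , x₂-col , vx₂ = by-class x₂-col λ where
              0 _ x₂∈B₀ → x₂∉B₀ x₂-col vx₂ x₂∈B₀ p-col vp p≁x₂
              1 _ x₂∈B₁ → x₂∉B₁′ x₂-col vx₂ x₂∈B₁
              2 _ x₂∈B₂ → colour≢class x₂-col x₂∈B₂
              3 _ x₂∈B₃ → y∉B₃ 0F x₃-col x₃∈B₂ x₀-col x₀∈B₃ d (class≢ w∈B₁) x₂-col vx₂ x₂∈B₃
              4 _ x₂∈B₄ → x₂∉B₄ x₂-col vx₂ x₂∈B₄ x₀-col vx₀ (x₀≁x₂ x₂∈B₄) p-col vp p≁x₂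
              (suc (suc (suc (suc (suc _))))) (s≤s (s≤s (s≤s (s≤s ())))) _
            where
            p≁x₂ = ≁-off-triangle vp vx₃ (~-sym x₃p) vx₂ x₃-col x₂-col
            x₀≁x₂ : class x₂ ≡ 4 → x₀ ≁ x₂
            x₀≁x₂ x₂∈B₄ with ~? x₀ x₂
            ... | inj₁ x₀x₂ = ⊥-elim (class≢ x₀∈B₃ (same-class-closed 4F vx₂ v∈B₄ x₂∈B₄ x₀v x₀x₂))
            ... | inj₂ x₀≁x₂ = x₀≁x₂

        x₃∉B₂ : ∀ {x₃} → Col 3 x₃ → v ~ x₃ → class x₃ ≡ 2 → ⊥
        x₃∉B₂ {x₃} x₃-col vx₃ x₃∈B₂ with v-neighbour 0 | v-neighbour 1
        ... | x₀ , x₀-col , vx₀ | x₁ , x₁-col , vx₁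
          with outcome x₃-col vx₃ x₀-col vx₀ (s≤s z≤n) | outcome x₃-col vx₃ x₁-col vx₁ (s≤s (s≤s z≤n))
        ... | inj₁ (inj₁ x₃∈B₀) | _ = class≢ x₃∈B₂ x₃∈B₀
        ... | _ | inj₁ (inj₁ x₃∈B₁) = class≢ x₃∈B₂ x₃∈B₁
        ... | inj₁ (inj₂ p₀) | inj₁ (inj₂ p₁) = contradiction (one-partner vx₃ p₀ p₁) λ ()
        ... | inj₁ (inj₂ (p , p-col , vp , x₃p)) | inj₂ d₁ = Partner₀Detour₁.absurd
          x₃-col vx₃ x₃∈B₂ p-col vp x₃p x₁-col d₁
          (DetourShape.xs∈B₃ (detour-shape 1F x₃-col x₁-col d₁)) (detour₁-w∈B₀ x₃-col x₃∈B₂ x₁-col d₁)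
        ... | inj₂ d₀ | inj₁ (inj₂ (p , p-col , vp , x₃p)) = Detour₀Partner₁.absurd
          x₃-col vx₃ x₃∈B₂ x₀-col d₀
          (DetourShape.xs∈B₃ (detour-shape 0F x₃-col x₀-col d₀)) (detour₀-w∈B₁ x₃-col x₃∈B₂ x₀-col d₀) p-col vp x₃p
        ... | inj₂ d₀ | inj₂ d₁ = y∉B₃ 0F x₃-col x₃∈B₂
          x₀-col (DetourShape.xs∈B₃ (detour-shape 0F x₃-col x₀-col d₀)) d₀
          (class≢ (detour₀-w∈B₁ x₃-col x₃∈B₂ x₀-col d₀))
          x₁-col vx₁ (DetourShape.xs∈B₃ (detour-shape 1F x₃-col x₁-col d₁))

        absurd : ⊥
        absurd with v-neighbour 0 | v-neighbour 1 | v-neighbour 2 | v-neighbour 3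
        ... | x₀ , x₀-col , vx₀ | x₁ , x₁-col , vx₁ | x₂ , x₂-col , vx₂ | x₃ , x₃-col , vx₃
          with class x₃ ℕ.≟ 1 | class x₃ ℕ.≟ 2
        ... | yes x₃∈B₁ | _ = x₃∉B₁ x₃-col vx₃ x₃∈B₁
        ... | _ | yes x₃∈B₂ = x₃∉B₂ x₃-col vx₃ x₃∈B₂
        ... | no x₃∉B₁ | no x₃∉B₂ =
          three-settled vx₃ (λ ()) (λ ()) (λ ())
            (settled 0F x₀-col vx₀) (settled 1F x₁-col vx₁) (settled 2F x₂-col vx₂)
          where
          settled : ∀ {xs} s {_ : True (toℕ s ℕ.<? 3)} → Col (toℕ s) xs → v ~ xs → Settled x₃ (toℕ s)
          settled s {s<3?} xs-col vxs = [ id , no-detour ]′ (outcome x₃-col vx₃ xs-col vxs (toWitness s<3?))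
            where
            no-detour : Detour x₃ _ (toℕ s) → Settled x₃ (toℕ s)
            no-detour d = ⊥-elim ([ x₃∉B₁ , x₃∉B₂ ]′ (between-1-and-2 (≤-<-trans z≤n w<x₃) x₃<3))
              where open DetourShape (detour-shape s {s<3?} x₃-col xs-col d)

      no-full-palette : ⊥
      no-full-palette with class v ℕ.≟ 4
      ... | yes v∈B₄ = InB₄.absurd v∈B₄
      ... | no v∉B₄ = ¬v∉B₄ v∉B₄

  key : H → Fin (6 ℕ.* n)
  key x = combine (fromℕ< (s≤s (class≤5 x))) (value x)

  key-injective : ∀ {x y} → key x ≡ key y → x ≡ y
  key-injective {x} {y} eq = value-injective
    (combine-injectiveʳ (fromℕ< (s≤s (class≤5 x))) (value x) (fromℕ< (s≤s (class≤5 y))) (value y) eq)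

  key<⇒class≤ : ∀ {x y} → toℕ (key x) ℕ.< toℕ (key y) → class x ≤ class y
  key<⇒class≤ {x} {y} kx<ky = ≮⇒≥ λ cy<cx → <-asym kx<ky (combine-monoˡ-< (value y) (value x)
    (subst₂ ℕ._<_ (sym (toℕ-fromℕ< (s≤s (class≤5 y)))) (sym (toℕ-fromℕ< (s≤s (class≤5 x)))) cy<cx))

  Done : ℕ → Fin n → Set
  Done m y = y ∈ A ⊎ Σ (y ∉ A) λ y∉A → toℕ (key (y , [ y∉A ])) ℕ.< m

  done? : ∀ m y → Dec (Done m y)
  done? m y with y ∈? A
  ... | yes y∈A = yes (inj₁ y∈A)
  ... | no y∉A = Dec.map′ (λ k<m → inj₂ (y∉A , k<m))
                          (λ { (inj₁ y∈A) → contradiction y∈A y∉A ; (inj₂ (_ , k<m)) → k<m })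
                          (toℕ (key (y , [ y∉A ])) ℕ.<? m)

  done⇒key< : ∀ {m} (x : H) → Done m (value x) → toℕ (key x) ℕ.< m
  done⇒key< x (inj₁ x∈A) = ⊥-elim (value∉A x x∈A)
  done⇒key< x (inj₂ (_ , k<m)) = k<m

  done-mono : ∀ {m y} → Done m y → Done (suc m) y
  done-mono = Sum.map₂ λ (y∉A , k<m) → y∉A , m≤n⇒m≤1+n k<m

  done-suc : ∀ {m y} → Done (suc m) y → Done m y ⊎ ∃ λ (x : H) → value x ≡ y × toℕ (key x) ≡ m
  done-suc (inj₁ y∈A) = inj₁ (inj₁ y∈A)
  done-suc (inj₂ (y∉A , k<1+m)) with m≤n⇒m<n∨m≡n (≤-pred k<1+m)
  ... | inj₁ k<m = inj₁ (inj₂ (y∉A , k<m))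
  ... | inj₂ k≡m = inj₂ ((_ , [ y∉A ]) , refl , k≡m)

  initial : FirstFitColouring (Done 0)
  initial = record
    { colour = colour₀ ; a-done = inj₁ ∘ a∈A ; colour-a = colour₀-a ; colour<5 = bounded
    ; proper = proper ; first-fit = λ { {x} (inj₁ x∈A) → ⊥-elim (value∉A x x∈A) } }
    where
    colour₀ : Fin n → ℕ
    colour₀ y with y ∈? A
    ... | yes y∈A = toℕ (proj₁ (A⊆a y∈A))
    ... | no _ = 0
    colour₀-∈ : ∀ {y} (y∈A : y ∈ A) → colour₀ y ≡ toℕ (proj₁ (A⊆a y∈A))
    colour₀-∈ {y} y∈A with y ∈? A
    ... | yes y∈A′ = cong toℕ (a-injective (trans (proj₂ (A⊆a y∈A′)) (sym (proj₂ (A⊆a y∈A)))))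
    ... | no y∉A = contradiction y∈A y∉A
    colour₀-a : ∀ k → colour₀ (a k) ≡ toℕ k
    colour₀-a k = trans (colour₀-∈ (a∈A k)) (cong toℕ (a-injective (proj₂ (A⊆a (a∈A k)))))
    bounded : ∀ {y} → Done 0 y → colour₀ y ℕ.< 5
    bounded (inj₁ y∈A) = subst (ℕ._< 5) (sym (colour₀-∈ y∈A)) (toℕ<n _)
    proper : ∀ {x y} → Done 0 x → Done 0 y → adj G x y ≡ true → colour₀ x ≢ colour₀ y
    proper (inj₁ x∈A) (inj₁ y∈A) xy eq = adj⇒≢ G xy (trans (sym (proj₂ (A⊆a x∈A)))
      (trans (cong a (toℕ-injective (trans (sym (colour₀-∈ x∈A)) (trans eq (colour₀-∈ y∈A))))) (proj₂ (A⊆a y∈A))))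

  colouring-cong : ∀ {P Q} → (∀ {y} → P y → Q y) → (∀ {y} → Q y → P y) → FirstFitColouring P → FirstFitColouring Q
  colouring-cong P⇒Q Q⇒P χ = record
    { colour = colour ; a-done = P⇒Q ∘ a-done ; colour-a = colour-a ; colour<5 = colour<5 ∘ Q⇒P
    ; proper = λ qx qy → proper (Q⇒P qx) (Q⇒P qy)
    ; first-fit = λ qx t<c →
        Sum.map₂ (λ (w , pw , xw , cw , w≤x) → w , P⇒Q pw , xw , cw , w≤x) (first-fit (Q⇒P qx) t<c) }
    where open FirstFitColouring χ

  module Step {m} (χ : FirstFitColouring (Done m)) (v : H) (v-next : toℕ (key v) ≡ m) where
    open FirstFitColouring χ
    open FirstFit χ using (Col; coloured; module Around)

    old-≢ : ∀ {y} → Done m y → value v ≢ y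
    old-≢ (inj₁ y∈A) refl = value∉A v y∈A
    old-≢ (inj₂ (_ , k<m)) refl = <-irrefl v-next k<m

    new-or-old : ∀ {y} → Done (suc m) y → value v ≡ y ⊎ Done m y
    new-or-old d with done-suc d
    ... | inj₁ old = inj₂ old
    ... | inj₂ (x , refl , k≡m) = inj₁ (cong value (key-injective (toℕ-injective (trans v-next (sym k≡m)))))

    v-last : ∀ {t x} → Col t x → class x ≤ class v
    v-last {x = x} x-col = key<⇒class≤ (subst (toℕ (key x) ℕ.<_) (sym v-next) (done⇒key< x (Col.done x-col)))

    Seen : Fin 5 → Set
    Seen t = ∃ λ y → Done m y × adj G (value v) y ≡ true × colour y ≡ toℕ t

    seen? : ∀ t → Dec (Seen t)
    seen? t = any? λ y → done? m y ×-dec (adj G (value v) y Bool.≟ true) ×-dec (colour y ℕ.≟ toℕ t)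

    some-colour-unseen : ¬ (∀ t → Seen t)
    some-colour-unseen all-seen = Around.no-full-palette v v-last λ t<5 →
      let y , dy , vy , cy = all-seen (fromℕ< t<5) in y , dy , vy , trans cy (toℕ-fromℕ< t<5)

    first-unseen : ∃ λ t → ¬ Seen t × ((j : Fin′ t) → Seen (inject j))
    first-unseen = ¬∀⟶∃¬-smallest 5 Seen seen? some-colour-unseen

    t = proj₁ first-unseen

    colour′ : Fin n → ℕ
    colour′ y with value v Fin.≟ y
    ... | yes _ = toℕ t
    ... | no _ = colour y

    colour′-v : colour′ (value v) ≡ toℕ t
    colour′-v with value v Fin.≟ value v
    ... | yes _ = refl
    ... | no v≢v = contradiction refl v≢v

    colour′-old : ∀ {y} → Done m y → colour′ y ≡ colour y
    colour′-old {y} dy with value v Fin.≟ y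
    ... | yes v≡y = contradiction v≡y (old-≢ dy)
    ... | no _ = refl

    proper′ : ∀ {x y} → Done (suc m) x → Done (suc m) y → adj G x y ≡ true → colour′ x ≢ colour′ y
    proper′ {x} {y} dx dy xy with new-or-old dx | new-or-old dy
    ... | inj₁ refl | inj₁ refl = λ _ → adj⇒≢ G xy refl
    ... | inj₁ refl | inj₂ dy-old = λ eq →
      proj₁ (proj₂ first-unseen) (y , dy-old , xy , trans (sym (colour′-old dy-old)) (trans (sym eq) colour′-v))
    ... | inj₂ dx-old | inj₁ refl = λ eq →
      proj₁ (proj₂ first-unseen)
        (x , dx-old , adj-sym G xy , trans (sym (colour′-old dx-old)) (trans eq colour′-v))
    ... | inj₂ dx-old | inj₂ dy-old = λ eq →
      proper dx-old dy-old xy (trans (sym (colour′-old dx-old)) (trans eq (colour′-old dy-old)))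

    FirstFitWitness : H → ℕ → Set
    FirstFitWitness x s =
      class x ≡ s ⊎ ∃ λ w → Done (suc m) (value w) × x ~ w × colour′ (value w) ≡ s × class w ≤ class x

    seen⇒witness : ∀ {s} → (∃ λ y → Done m y × adj G (value v) y ≡ true × colour y ≡ s) → FirstFitWitness v s
    seen⇒witness (y , dy , vy , cy) with y ∈? A
    ... | yes y∈A with A⊆a y∈A
    ...   | k , refl = inj₁ (trans (~ᴬ⇒class (edgeᴬ vy)) (trans (sym (colour-a k)) cy))
    seen⇒witness (y , dy , vy , cy) | no y∉A =
      inj₂ ((y , [ y∉A ]) , done-mono dy , edge vy , trans (colour′-old dy) cy , v-last (coloured dy cy))

    first-fit′ : ∀ {x : H} {s} → Done (suc m) (value x) → s ℕ.< colour′ (value x) → FirstFitWitness x s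
    first-fit′ {x} {s} dx s<c with new-or-old dx
    ... | inj₂ dx-old =
      Sum.map₂ (λ (w , dw , xw , cw , w≤x) → w , done-mono dw , xw , trans (colour′-old dw) cw , w≤x)
               (first-fit dx-old (subst (s ℕ.<_) (colour′-old dx-old) s<c))
    ... | inj₁ v≡x = subst (λ x → FirstFitWitness x s) (value-injective v≡x) (seen⇒witness
          (let y , dy , vy , cy = proj₂ (proj₂ first-unseen) (fromℕ< s<t) in
           y , dy , vy , trans cy (trans (toℕ-inject (fromℕ< s<t)) (toℕ-fromℕ< s<t))))
      where s<t = subst (s ℕ.<_) (trans (cong colour′ (sym v≡x)) colour′-v) s<c

    extended : FirstFitColouring (Done (suc m))
    extended = record
      { colour = colour′ ; a-done = inj₁ ∘ a∈A
      ; colour-a = λ k → trans (colour′-old (inj₁ (a∈A k))) (colour-a k)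
      ; colour<5 = λ dy → [ (λ { refl → subst (ℕ._< 5) (sym colour′-v) (toℕ<n t) })
                          , (λ dy-old → subst (ℕ._< 5) (sym (colour′-old dy-old)) (colour<5 dy-old))
                          ]′ (new-or-old dy)
      ; proper = proper′ ; first-fit = first-fit′ }

  next? : ∀ m → Dec (∃ λ (x : H) → toℕ (key x) ≡ m)
  next? m = Dec.map′ (λ (y , y∉A , k≡m) → (y , [ y∉A ]) , k≡m) (λ (x , k≡m) → value x , value∉A x , k≡m)
              (any? candidate?)
    where
    candidate? : ∀ y → Dec (Σ (y ∉ A) λ y∉A → toℕ (key (y , [ y∉A ])) ≡ m)
    candidate? y with y ∈? A
    ... | yes y∈A = no λ (y∉A , _) → y∉A y∈A
    ... | no y∉A = Dec.map′ (y∉A ,_) proj₂ (toℕ (key (y , [ y∉A ])) ℕ.≟ m)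

  stage : ∀ m → FirstFitColouring (Done m)
  stage zero = initial
  stage (suc m) with next? m
  ... | yes (v , v-next) = Step.extended (stage m) v v-next
  ... | no none = colouring-cong done-mono
                    (λ d → [ id , (λ (x , _ , k≡m) → ⊥-elim (none (x , k≡m))) ]′ (done-suc d)) (stage m)

  all-done : ∀ y → Done (6 ℕ.* n) y
  all-done y with y ∈? A
  ... | yes y∈A = inj₁ y∈A
  ... | no y∉A = inj₂ (y∉A , toℕ<n (key (y , [ y∉A ])))

  five-colouring : Σ (Fin n → Fin 5) (IsProperColouring G)
  five-colouring = (λ y → fromℕ< (colour<5 (all-done y))) , λ x y xy eq →
    proper (all-done x) (all-done y) xy (trans (sym (toℕ-fromℕ< _)) (trans (cong toℕ eq) (toℕ-fromℕ< _)))
    where open FirstFitColouring (stage (6 ℕ.* n))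

  A-colours-distinct : ∀ {d} (col : Fin n → Fin d) → IsProperColouring G col → Injective _≡_ _≡_ (col ∘ a)
  A-colours-distinct col col-proper {j} {k} eq with j Fin.≟ k
  ... | yes j≡k = j≡k
  ... | no j≢k = contradiction eq (col-proper (a j) (a k) (a-adj j≢k))

lemma3p3 : (n : ℕ) (G : Graph n) → Free P2∪P4 G → Free diamond G →
    CliqueNumber G 5 → (A : Subset n) → IsMaximumClique G A →
    (∃ λ (v : Fin n) → v ∉ A) → CliqueNumberOn G (∁ A) 3 →
    ChromaticNumber G 5
lemma3p3 n G P2∪P4-free diamond-free ((K , _ , K-clique , ∣K∣≡5) , ω≤5) A A-maximum _ (_ , ω[H]≤3) =
  five-colouring , λ _ col col-proper → injective⇒≤ (A-colours-distinct col col-proper)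
  where
  ∣A∣≡5 : ∣ A ∣ ≡ 5
  ∣A∣≡5 = ≤-antisym (ω≤5 A (λ _ → ∈⊤) (proj₁ A-maximum)) (subst (_≤ ∣ A ∣) ∣K∣≡5 (proj₂ A-maximum K K-clique))
  open Structure P2∪P4-free diamond-free A-maximum ∣A∣≡5 ω[H]≤3
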